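{- Let $D=(V,A)$ be a semicomplete digraph with three distinct vertices $x,y,z$. Then $(x,y)\Gamma(x,z)$ if and only if the arc between $y$ and $z$ is non-symmetric and the subdigraph induced by $\{x,y,z\}$ contains a directed triangle.
   Context: A digraph $D=(V,A)$ is finite, without loops or multiple arcs; write $uv\in A$ for an arc. $D$ is semicomplete if for any two distinct vertices $u,v$ at least one of $uv,vu$ is in $A$. The arc between $u$ and $v$ is non-symmetric if exactly one of $uv,vu$ lies in $A$. A directed triangle on $\{x,y,z\}$ means an ordering $a,b,c$ of these vertices with $ab,bc,ca\in A$. Let $Z_D=\{(x,y): xy\in A\text{ or }yx\in A\}$. For $(x,y),(x',y')\in Z_D$ write $(x,y)\Gamma(x',y')$ if one of the following holds: (i) $x=x'$ and $y=y'$; (ii) $x=x'$, $y\ne y'$, and either ($yx,x'y'\in A$ and $yy'\notin A$) or ($y'x',xy\in A$ and $y'y\notin A$); (iii) $y=y'$, $x\ne x'$, and either ($xy,y'x'\in A$ and $xx'\notin A$) or ($x'y',yx\in A$ and $x'x\notin A$). -}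

module Defs where

open import Data.Nat using (ℕ)
open import Data.Fin using (Fin)
open import Data.Bool using (Bool; T)
open import Data.Product using (_×_; ∃-syntax)
open import Data.Sum using (_⊎_)
open import Relation.Nullary using (¬_)
open import Relation.Binary.PropositionalEquality using (_≡_)

-- A finite digraph on vertex set Fin n: arc relation given by a Boolean
-- adjacency function (finite digraph, so membership uv ∈ A is decidable);
-- no loops.
record Digraph (n : ℕ) : Set where
  field
    arc      : Fin n → Fin n → Bool
    loopless : ∀ v → ¬ T (arc v v)

open Digraph public

_⟶[_]_ : ∀ {n} → Fin n → Digraph n → Fin n → Set
u ⟶[ D ] v = T (arc D u v)

Semicomplete : ∀ {n} → Digraph n → Set
Semicomplete D = ∀ u v → ¬ u ≡ v → (u ⟶[ D ] v) ⊎ (v ⟶[ D ] u)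

NonSymmetric : ∀ {n} → Digraph n → Fin n → Fin n → Set
NonSymmetric D u v =
  ((u ⟶[ D ] v) × ¬ (v ⟶[ D ] u)) ⊎ ((v ⟶[ D ] u) × ¬ (u ⟶[ D ] v))

IsOrderingOf : ∀ {n} → Fin n → Fin n → Fin n → Fin n → Fin n → Fin n → Set
IsOrderingOf x y z a b c =
    (a ≡ x × b ≡ y × c ≡ z) ⊎ (a ≡ x × b ≡ z × c ≡ y)
  ⊎ (a ≡ y × b ≡ x × c ≡ z) ⊎ (a ≡ y × b ≡ z × c ≡ x)
  ⊎ (a ≡ z × b ≡ x × c ≡ y) ⊎ (a ≡ z × b ≡ y × c ≡ x)

HasDirectedTriangle : ∀ {n} → Digraph n → Fin n → Fin n → Fin n → Set
HasDirectedTriangle D x y z =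
  ∃[ a ] ∃[ b ] ∃[ c ] (IsOrderingOf x y z a b c
    × (a ⟶[ D ] b) × (b ⟶[ D ] c) × (c ⟶[ D ] a))

InZ : ∀ {n} → Digraph n → Fin n → Fin n → Set
InZ D x y = (x ⟶[ D ] y) ⊎ (y ⟶[ D ] x)

-- The relation Γ on Z_D, clauses (i)-(iii) verbatim
Γ : ∀ {n} → (D : Digraph n) → Fin n → Fin n → Fin n → Fin n → Set
Γ D x y x' y' =
    (x ≡ x' × y ≡ y')
  ⊎ (x ≡ x' × ¬ y ≡ y' ×
       (((y ⟶[ D ] x) × (x' ⟶[ D ] y') × ¬ (y ⟶[ D ] y'))
       ⊎ ((y' ⟶[ D ] x') × (x ⟶[ D ] y) × ¬ (y' ⟶[ D ] y))))
  ⊎ (y ≡ y' × ¬ x ≡ x' ×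
       (((x ⟶[ D ] y) × (y' ⟶[ D ] x') × ¬ (x ⟶[ D ] x'))
       ⊎ ((x' ⟶[ D ] y') × (y ⟶[ D ] x) × ¬ (x' ⟶[ D ] x))))

-- A directed triangle on {x, y, z} is one of the two cyclic orientations
-- x → y → z → x or x → z → y → x.  Since y ≠ z, only clause (ii) of Γ can
-- hold for (x, y) and (x, z), and each of its two alternatives says that
-- the arc between y and z is one-way and, by semicompleteness, closes one
-- of the two orientations into a directed triangle.
module Submission where

open import Defs
open import Data.Fin using (Fin)
open import Data.Product using (_×_; _,_)
open import Data.Product.Function.NonDependent.Propositional using (_×-⇔_)
open import Data.Sum using (_⊎_; inj₁; inj₂)
open import Data.Sum.Function.Propositional using (_⊎-⇔_)
open import Function.Base using (_∘_)
open import Function.Bundles using (_⇔_; mk⇔)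
open import Function.Construct.Identity using (⇔-id)
open import Function.Construct.Symmetry using (⇔-sym)
open import Function.Properties.Equivalence using (⇔-setoid)
open import Level using (0ℓ)
open import Relation.Nullary using (¬_; contradiction)
open import Relation.Binary.PropositionalEquality using (_≡_; refl; sym)
open import Relation.Binary.Reasoning.Setoid (⇔-setoid 0ℓ)

×-distrib-⊎-exclusive : {P Q A B : Set} → (P → ¬ B) → (Q → ¬ A) →
  ((Q × B) ⊎ (P × A)) ⇔ ((P ⊎ Q) × (A ⊎ B))
×-distrib-⊎-exclusive {P} {Q} {A} {B} p⇒¬b q⇒¬a = mk⇔ to from
  where
  to : (Q × B) ⊎ (P × A) → (P ⊎ Q) × (A ⊎ B)
  to (inj₁ (q , b)) = inj₂ q , inj₂ b
  to (inj₂ (p , a)) = inj₁ p , inj₁ a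

  from : (P ⊎ Q) × (A ⊎ B) → (Q × B) ⊎ (P × A)
  from (inj₁ p , inj₁ a) = inj₂ (p , a)
  from (inj₁ p , inj₂ b) = contradiction b (p⇒¬b p)
  from (inj₂ q , inj₁ a) = contradiction a (q⇒¬a q)
  from (inj₂ q , inj₂ b) = inj₁ (q , b)

module _ {n} (D : Digraph n) where

  OneWay : Fin n → Fin n → Set
  OneWay u v = (u ⟶[ D ] v) × ¬ (v ⟶[ D ] u)

  DirectedCycle : Fin n → Fin n → Fin n → Set
  DirectedCycle a b c = (a ⟶[ D ] b) × (b ⟶[ D ] c) × (c ⟶[ D ] a)

  directedCycle-rotate : ∀ {a b c} → DirectedCycle a b c → DirectedCycle b c a
  directedCycle-rotate (ab , bc , ca) = bc , ca , ab

  hasDirectedTriangle⇔ : ∀ x y z →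
    HasDirectedTriangle D x y z ⇔ (DirectedCycle x y z ⊎ DirectedCycle x z y)
  hasDirectedTriangle⇔ x y z = mk⇔ to from
    where
    to : HasDirectedTriangle D x y z → DirectedCycle x y z ⊎ DirectedCycle x z y
    to (_ , _ , _ , inj₁ (refl , refl , refl) , c) = inj₁ c
    to (_ , _ , _ , inj₂ (inj₁ (refl , refl , refl)) , c) = inj₂ c
    to (_ , _ , _ , inj₂ (inj₂ (inj₁ (refl , refl , refl))) , c) =
      inj₂ (directedCycle-rotate c)
    to (_ , _ , _ , inj₂ (inj₂ (inj₂ (inj₁ (refl , refl , refl)))) , c) =
      inj₁ (directedCycle-rotate (directedCycle-rotate c))
    to (_ , _ , _ , inj₂ (inj₂ (inj₂ (inj₂ (inj₁ (refl , refl , refl))))) , c) =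
      inj₁ (directedCycle-rotate c)
    to (_ , _ , _ , inj₂ (inj₂ (inj₂ (inj₂ (inj₂ (refl , refl , refl))))) , c) =
      inj₂ (directedCycle-rotate (directedCycle-rotate c))

    from : DirectedCycle x y z ⊎ DirectedCycle x z y → HasDirectedTriangle D x y z
    from (inj₁ c) = x , y , z , inj₁ (refl , refl , refl) , c
    from (inj₂ c) = x , z , y , inj₂ (inj₁ (refl , refl , refl)) , c

  Γ-sameSource⇔ : ∀ {x y z} → ¬ y ≡ z →
    Γ D x y x z ⇔ (((y ⟶[ D ] x) × (x ⟶[ D ] z) × ¬ (y ⟶[ D ] z))
                 ⊎ ((z ⟶[ D ] x) × (x ⟶[ D ] y) × ¬ (z ⟶[ D ] y)))
  Γ-sameSource⇔ y≢z = mk⇔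
    (λ where
      (inj₁ (_ , y≡z))             → contradiction y≡z y≢z
      (inj₂ (inj₁ (_ , _ , arcs))) → arcs
      (inj₂ (inj₂ (y≡z , _)))      → contradiction y≡z y≢z)
    (λ arcs → inj₂ (inj₁ (refl , y≢z , arcs)))

  oneWay×directedCycle⇔ : Semicomplete D → ∀ {a b c} → ¬ b ≡ c →
    ((c ⟶[ D ] a) × (a ⟶[ D ] b) × ¬ (c ⟶[ D ] b))
      ⇔ (OneWay b c × DirectedCycle a b c)
  oneWay×directedCycle⇔ semicomplete {a} {b} {c} b≢c = mk⇔ to from
    where
    to : (c ⟶[ D ] a) × (a ⟶[ D ] b) × ¬ (c ⟶[ D ] b) → OneWay b c × DirectedCycle a b c
    to (ca , ab , ¬cb) with semicomplete b c b≢c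
    ... | inj₁ bc = (bc , ¬cb) , ab , bc , ca
    ... | inj₂ cb = contradiction cb ¬cb

    from : OneWay b c × DirectedCycle a b c → (c ⟶[ D ] a) × (a ⟶[ D ] b) × ¬ (c ⟶[ D ] b)
    from ((_ , ¬cb) , ab , _ , ca) = ca , ab , ¬cb

mainTheorem13 : ∀ {n} (D : Digraph n) → Semicomplete D →
    (x y z : Fin n) → ¬ x ≡ y → ¬ x ≡ z → ¬ y ≡ z →
    Γ D x y x z ⇔ (NonSymmetric D y z × HasDirectedTriangle D x y z)
mainTheorem13 D semicomplete x y z _ _ y≢z = begin
  Γ D x y x z
    ≈⟨ Γ-sameSource⇔ D y≢z ⟩
  (((y ⟶[ D ] x) × (x ⟶[ D ] z) × ¬ (y ⟶[ D ] z))
    ⊎ ((z ⟶[ D ] x) × (x ⟶[ D ] y) × ¬ (z ⟶[ D ] y)))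
    ≈⟨ oneWay×directedCycle⇔ D semicomplete (y≢z ∘ sym)
       ⊎-⇔ oneWay×directedCycle⇔ D semicomplete y≢z ⟩
  ((OneWay D z y × DirectedCycle D x z y) ⊎ (OneWay D y z × DirectedCycle D x y z))
    ≈⟨ ×-distrib-⊎-exclusive (λ (_ , ¬zy) (_ , zy , _) → ¬zy zy)
                             (λ (_ , ¬yz) (_ , yz , _) → ¬yz yz) ⟩
  (NonSymmetric D y z × (DirectedCycle D x y z ⊎ DirectedCycle D x z y))
    ≈⟨ ⇔-id _ ×-⇔ ⇔-sym (hasDirectedTriangle⇔ D x y z) ⟩
  (NonSymmetric D y z × HasDirectedTriangle D x y z) ∎
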